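{- Let $m=2^n$ with $n>2$ and let $S=\{1,\frac m2-2,\frac m2\}=\{1,2^{n-1}-2,2^{n-1}\}$. Then the circulant graph $G=C_m(S)$ does not admit an open XOR-magic labeling.
   Context: For $m\ge 4$ and $S\subseteq\{1,2,\ldots,\lfloor m/2\rfloor\}$, the circulant graph $C_m(S)$ has vertices $x_0,\ldots,x_{m-1}$, and distinct $x_i,x_j$ are adjacent if and only if $|i-j|\in\{s,\,m-s : s\in S\}$. For a vertex $x$, $N(x)$ is its set of neighbours. An open XOR-magic labeling of a graph $G=(V,E)$ with $|V|=2^n$ is a bijection $\ell:V\to(\mathbb{Z}_2)^n$ such that $\sum_{y\in N(x)}\ell(y)$ is the zero vector of $(\mathbb{Z}_2)^n$ for every $x\in V$. -}

module Defs where

open import Data.Nat using (ℕ; _+_; _∸_; _≟_)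
open import Data.Fin using (Fin; toℕ)
open import Data.Fin.Properties using () renaming (_≟_ to _≟ᶠ_)
open import Data.Bool using (Bool; _xor_)
open import Data.Vec using (Vec; replicate; zipWith)
open import Data.List using (List; foldr; filter; allFin)
open import Data.List.Relation.Unary.Any using (Any; any?)
open import Data.Product using (_×_)
import Data.Product
import Data.List
import Data.Bool
open import Data.Sum using (_⊎_)
open import Relation.Nullary using (¬_; Dec)
open import Relation.Nullary.Decidable using (_×-dec_; _⊎-dec_; ¬?)
open import Relation.Binary.PropositionalEquality using (_≡_; _≢_)
open import Function.Bundles using (_⤖_; Bijection)

absDiff : ℕ → ℕ → ℕ
absDiff a b = (a ∸ b) + (b ∸ a)

CircAdj : (m : ℕ) (S : List ℕ) → Fin m → Fin m → Set
CircAdj m S i j =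
  i ≢ j × Any (λ s → absDiff (toℕ i) (toℕ j) ≡ s ⊎ absDiff (toℕ i) (toℕ j) ≡ m ∸ s) S

circAdj? : (m : ℕ) (S : List ℕ) → (i j : Fin m) → Dec (CircAdj m S i j)
circAdj? m S i j =
  ¬? (i ≟ᶠ j) ×-dec
  any? (λ s → (absDiff (toℕ i) (toℕ j) ≟ s) ⊎-dec (absDiff (toℕ i) (toℕ j) ≟ m ∸ s)) S

neighbours : (m : ℕ) (S : List ℕ) → Fin m → List (Fin m)
neighbours m S i = filter (circAdj? m S i) (allFin m)

Z2^ : ℕ → Set
Z2^ n = Vec Bool n

zeroV : (n : ℕ) → Z2^ n
zeroV n = replicate n Data.Bool.false

_⊕_ : {n : ℕ} → Z2^ n → Z2^ n → Z2^ n
_⊕_ = zipWith _xor_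

sumV : {n : ℕ} → List (Z2^ n) → Z2^ n
sumV {n} = foldr _⊕_ (zeroV n)

OpenXORMagicLabeling : (m n : ℕ) (S : List ℕ) → Set
OpenXORMagicLabeling m n S =
  Data.Product.Σ (Fin m ⤖ Z2^ n) λ ℓ →
    (i : Fin m) → sumV (Data.List.map (Bijection.to ℓ) (neighbours m S i)) ≡ zeroV n

-- Write m = 2h and read a labelling L along ℕ as the m-periodic function G y = L (y mod m).
-- The neighbours of x are x ± 1, x ± (h − 2) and x + h, so adding the vanishing neighbourhood
-- sums at x and x + h shows that the h-periodic function F y = G y + G (y + h) sums to zero
-- over these offsets, which modulo h are x − 2, …, x + 2.  Thus any five consecutive values
-- of F sum to zero, so F has period 5 besides h, hence period gcd(5, h) = 1 when 5 ∤ h.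
-- As every label has order 2, F 0 = 5 · F 0 = 0, i.e. L 0 = L h, contradicting injectivity.
module Submission where

open import Defs
open import Algebra.Bundles using (CommutativeMonoid)
open import Algebra.Structures using (IsCommutativeMonoid)
open import Data.Bool.Properties using (xor-assoc; xor-comm; xor-identityˡ; xor-identityʳ; xor-same)
open import Data.Fin using (Fin; toℕ)
open import Data.Fin.Properties using (toℕ-fromℕ<; toℕ-injective; toℕ<n; fromℕ<-cong)
open import Data.List using (List; []; _∷_; map; allFin)
open import Data.List.Membership.Propositional using (_∈_)
open import Data.List.Membership.Propositional.Properties using (∈-filter⁺; ∈-filter⁻; ∈-allFin)
open import Data.List.Membership.Propositional.Properties.WithK using (unique∧set⇒bag)
open import Data.List.Properties using (map-cong; map-∘)
open import Data.List.Relation.Binary.BagAndSetEquality using (∼bag⇒↭)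
open import Data.List.Relation.Binary.Permutation.Propositional using (_↭_; ↭-sym; ↭⇒↭ₛ)
open import Data.List.Relation.Binary.Permutation.Propositional.Properties using () renaming (map⁺ to ↭-map⁺)
open import Data.List.Relation.Binary.Permutation.Setoid.Properties using (foldr-commMonoid)
open import Data.List.Relation.Unary.All as All using (All; []; _∷_)
open import Data.List.Relation.Unary.All.Properties using (All¬⇒¬Any)
import Data.List.Relation.Unary.AllPairs as AllPairs
open import Data.List.Relation.Unary.AllPairs.Properties using () renaming (map⁺ to AllPairs-map⁺)
open import Data.List.Relation.Unary.Any using (Any; here; there)
open import Data.List.Relation.Unary.Any.Properties using (map↔)
open import Data.List.Relation.Unary.Linked using (Linked; [-]; _∷_)
open import Data.List.Relation.Unary.Linked.Properties using (Linked⇒AllPairs)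
open import Data.List.Relation.Unary.Unique.Propositional using (Unique)
open import Data.List.Relation.Unary.Unique.Propositional.Properties using (filter⁺; allFin⁺)
open import Data.Nat using (ℕ; zero; suc; _+_; _*_; _∸_; _^_; _<_; _≤_; _>_; _<?_; _≤?_; z<s; s≤s; z≤n; NonZero; nonTrivial⇒≢1)
open import Data.Nat.Coprimality using (Coprime; coprime⇒gcd≡1)
open import Data.Nat.Divisibility using (_∤_; ∣1⇒≡1; >⇒∤)
open import Data.Nat.DivMod using (_%_; _mod_; %-distribˡ-+; m%n%n≡m%n; m%n<n; m<n⇒m%n≡m; [m+n]%n≡m%n; m≤n⇒[n∸m]%m≡n%m)
open import Data.Nat.GCD using (gcd; gcd-GCD; module Bézout)
open import Data.Nat.Primality using (Prime; prime?; prime⇒irreducible; prime⇒nonTrivial; euclidsLemma)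
open import Data.Nat.Properties
open import Data.Nat.Tactic.RingSolver using (solve-∀)
open import Data.Product using (_×_; _,_; proj₂)
open import Data.Sum using (_⊎_; inj₁; inj₂; [_,_]′)
open import Data.Sum.Algebra using (⊎-comm)
open import Data.Sum.Function.Propositional using (_⊎-⇔_)
open import Data.Vec.Properties using (zipWith-assoc; zipWith-comm; zipWith-identityˡ; zipWith-identityʳ; zipWith-inverseʳ; map-id)
open import Function using (_∘_; id)
open import Function.Bundles using (_⇔_; mk⇔; Equivalence; Bijection)
open import Function.Definitions using (Injective)
open import Function.Properties.Equivalence using () renaming (sym to ⇔-sym; trans to ⇔-trans)
open import Function.Related.Propositional using (module EquationalReasoning)
open import Relation.Binary.PropositionalEquality
open import Relation.Binary.PropositionalEquality.Algebra using (isMagma)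
open import Relation.Nullary using (¬_; yes; no; contradiction)
open import Relation.Nullary.Decidable using (from-yes)

≡-sym-⇔ : {A : Set} {x y : A} → (x ≡ y) ⇔ (y ≡ x)
≡-sym-⇔ = mk⇔ sym sym

Any-map-All : {A : Set} {P Q : A → Set} {xs : List A} → All (λ x → P x → Q x) xs → Any P xs → Any Q xs
Any-map-All (f ∷ _)  (here p)  = here (f p)
Any-map-All (_ ∷ fs) (there p) = there (Any-map-All fs p)

module _ {k : ℕ} where

  ⊕-isCommutativeMonoid : IsCommutativeMonoid _≡_ (_⊕_ {k}) (zeroV k)
  ⊕-isCommutativeMonoid = record
    { isMonoid = record
      { isSemigroup = record { isMagma = isMagma _⊕_ ; assoc = zipWith-assoc xor-assoc }
      ; identity    = zipWith-identityˡ xor-identityˡ , zipWith-identityʳ xor-identityʳ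
      }
    ; comm = zipWith-comm xor-comm
    }

  ⊕-same : (x : Z2^ k) → x ⊕ x ≡ zeroV k
  ⊕-same x = trans (cong (x ⊕_) (sym (map-id x))) (zipWith-inverseʳ {⁻¹ = id} xor-same x)

⊕-commutativeMonoid : ℕ → CommutativeMonoid _ _
⊕-commutativeMonoid k = record { isCommutativeMonoid = ⊕-isCommutativeMonoid {k} }

module _ {k : ℕ} where
  open CommutativeMonoid (⊕-commutativeMonoid k) using (assoc; identityˡ; identityʳ; commutativeSemigroup)
  open import Algebra.Properties.CommutativeSemigroup commutativeSemigroup using (interchange)
  open ≡-Reasoning

  ⊕≡zero⇒≡ : {x y : Z2^ k} → x ⊕ y ≡ zeroV k → x ≡ y
  ⊕≡zero⇒≡ {x} {y} x⊕y≡0 = begin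
    x                ≡⟨ identityʳ x ⟨
    x ⊕ zeroV k      ≡⟨ cong (x ⊕_) (⊕-same y) ⟨
    x ⊕ (y ⊕ y)      ≡⟨ assoc x y y ⟨
    (x ⊕ y) ⊕ y      ≡⟨ cong (_⊕ y) x⊕y≡0 ⟩
    zeroV k ⊕ y      ≡⟨ identityˡ y ⟩
    y                ∎

  x⊕x⊕x⊕x⊕x≡x : (x : Z2^ k) → x ⊕ (x ⊕ (x ⊕ (x ⊕ x))) ≡ x
  x⊕x⊕x⊕x⊕x≡x x = begin
    x ⊕ (x ⊕ (x ⊕ (x ⊕ x)))    ≡⟨ cong (λ y → x ⊕ (x ⊕ (x ⊕ y))) (⊕-same x) ⟩
    x ⊕ (x ⊕ (x ⊕ zeroV k))    ≡⟨ cong (λ y → x ⊕ (x ⊕ y)) (identityʳ x) ⟩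
    x ⊕ (x ⊕ x)                ≡⟨ cong (x ⊕_) (⊕-same x) ⟩
    x ⊕ zeroV k                ≡⟨ identityʳ x ⟩
    x                          ∎

  sumV-↭ : {xs ys : List (Z2^ k)} → xs ↭ ys → sumV xs ≡ sumV ys
  sumV-↭ p = foldr-commMonoid (setoid (Z2^ k)) ⊕-isCommutativeMonoid (↭⇒↭ₛ p)

  sumV-map-⊕ : {A : Set} (f g : A → Z2^ k) (xs : List A) →
               sumV (map (λ x → f x ⊕ g x) xs) ≡ sumV (map f xs) ⊕ sumV (map g xs)
  sumV-map-⊕ f g []       = sym (identityˡ (zeroV k))
  sumV-map-⊕ f g (x ∷ xs) = trans (cong ((f x ⊕ g x) ⊕_) (sumV-map-⊕ f g xs)) (interchange (f x) (g x) _ _)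

Periodic : {A : Set} → (ℕ → A) → ℕ → Set
Periodic F d = ∀ y → F (y + d) ≡ F y

module _ {A : Set} {F : ℕ → A} where
  open ≡-Reasoning

  periodic-* : ∀ {d} → Periodic F d → ∀ q → Periodic F (q * d)
  periodic-* {d} per zero    y = cong F (+-identityʳ y)
  periodic-* {d} per (suc q) y = begin
    F (y + (d + q * d))  ≡⟨ cong F (+-assoc y d (q * d)) ⟨
    F (y + d + q * d)    ≡⟨ periodic-* per q (y + d) ⟩
    F (y + d)            ≡⟨ per y ⟩
    F y                  ∎

  periodic-∸ : ∀ {d e g} → g + e ≡ d → Periodic F d → Periodic F e → Periodic F g
  periodic-∸ {d} {e} {g} g+e≡d per-d per-e y = begin
    F (y + g)        ≡⟨ per-e (y + g) ⟨
    F (y + g + e)    ≡⟨ cong F (trans (+-assoc y g e) (cong (y +_) g+e≡d)) ⟩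
    F (y + d)        ≡⟨ per-d y ⟩
    F y              ∎

  periodic-gcd : ∀ {d e} → Periodic F d → Periodic F e → Periodic F (gcd d e)
  periodic-gcd {d} {e} per-d per-e with Bézout.identity (gcd-GCD d e)
  ... | Bézout.+- x y eq = periodic-∸ eq (periodic-* per-d x) (periodic-* per-e y)
  ... | Bézout.-+ x y eq = periodic-∸ eq (periodic-* per-e y) (periodic-* per-d x)

  periodic-1⇒constant : Periodic F 1 → ∀ y → F y ≡ F 0
  periodic-1⇒constant per zero    = refl
  periodic-1⇒constant per (suc y) = trans (cong F (+-comm 1 y)) (trans (per y) (periodic-1⇒constant per y))

m+n≡m+o+p⇒p≤n : ∀ {m n o p} → m + n ≡ m + o + p → p ≤ n
m+n≡m+o+p⇒p≤n {m} {n} {o} {p} e = subst (p ≤_) (sym (+-cancelˡ-≡ m n (o + p) (trans e (+-assoc m o p)))) (m≤n+m p o)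

m+n≡o⇔m≡o∸n : ∀ {m n o} → n ≤ o → (m + n ≡ o) ⇔ (m ≡ o ∸ n)
m+n≡o⇔m≡o∸n {m} {n} n≤o = mk⇔ (λ { refl → sym (m+n∸n≡m m n) }) (λ { refl → m∸n+n≡m n≤o })

m+[o∸n]≡o⇔m≡n : ∀ {m n o} → n ≤ o → (m + (o ∸ n) ≡ o) ⇔ (m ≡ n)
m+[o∸n]≡o⇔m≡n {m} {n} {o} n≤o = mk⇔ (λ e → +-cancelʳ-≡ (o ∸ n) m n (trans e (sym (m+[n∸m]≡n n≤o))))
                                    (λ { refl → m+[n∸m]≡n n≤o })

absDiff[m,m+n]≡n : ∀ m n → absDiff m (m + n) ≡ n
absDiff[m,m+n]≡n m n rewrite m+n∸m≡n m n | m≤n⇒m∸n≡0 (m≤m+n m n) = refl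

absDiff[m+n,m]≡n : ∀ m n → absDiff (m + n) m ≡ n
absDiff[m+n,m]≡n m n rewrite m+n∸m≡n m n | m≤n⇒m∸n≡0 (m≤m+n m n) = +-identityʳ n

absDiff[n,n]≡0 : ∀ n → absDiff n n ≡ 0
absDiff[n,n]≡0 n = cong₂ _+_ (n∸n≡0 n) (n∸n≡0 n)

[m%d+n]%d≡[m+n]%d : ∀ m n d .{{_ : NonZero d}} → (m % d + n) % d ≡ (m + n) % d
[m%d+n]%d≡[m+n]%d m n d = begin
  (m % d + n) % d            ≡⟨ %-distribˡ-+ (m % d) n d ⟩
  (m % d % d + n % d) % d    ≡⟨ cong (λ x → (x + n % d) % d) (m%n%n≡m%n m d) ⟩
  (m % d + n % d) % d        ≡⟨ %-distribˡ-+ m n d ⟨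
  (m + n) % d                ∎
  where open ≡-Reasoning

module _ {m : ℕ} .{{_ : NonZero m}} where

  x%m≡b⇒x≡b⊎x≡b+m : ∀ {x b} → b < m → x < m + m → x % m ≡ b → x ≡ b ⊎ x ≡ b + m
  x%m≡b⇒x≡b⊎x≡b+m {x} {b} b<m x<2m x%m≡b with x <? m
  ... | yes x<m = inj₁ (trans (sym (m<n⇒m%n≡m x<m)) x%m≡b)
  ... | no  x≮m = inj₂ (begin
      x              ≡⟨ m∸n+n≡m m≤x ⟨
      (x ∸ m) + m    ≡⟨ cong (_+ m) x∸m≡b ⟩
      b + m          ∎)
    where
    open ≡-Reasoning
    m≤x = ≮⇒≥ x≮m
    x∸m<m : x ∸ m < m
    x∸m<m = +-cancelʳ-< m (x ∸ m) m (subst (_< m + m) (sym (m∸n+n≡m m≤x)) x<2m)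
    x∸m≡b : x ∸ m ≡ b
    x∸m≡b = trans (sym (m<n⇒m%n≡m x∸m<m)) (trans (m≤n⇒[n∸m]%m≡n%m m≤x) x%m≡b)

  [a+t]%m≡a+d⇔t≡d : ∀ {a d t} → a + d < m → t < m → ((a + t) % m ≡ a + d) ⇔ (t ≡ d)
  [a+t]%m≡a+d⇔t≡d {a} {d} {t} a+d<m t<m = mk⇔ to (λ { refl → m<n⇒m%n≡m a+d<m })
    where
    to : (a + t) % m ≡ a + d → t ≡ d
    to e with x%m≡b⇒x≡b⊎x≡b+m a+d<m (+-mono-< (≤-<-trans (m≤m+n a d) a+d<m) t<m) e
    ... | inj₁ a+t≡a+d   = +-cancelˡ-≡ a t d a+t≡a+d
    ... | inj₂ a+t≡a+d+m = contradiction (m+n≡m+o+p⇒p≤n a+t≡a+d+m) (<⇒≱ t<m)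

  [b+d+t]%m≡b⇔d+t≡m : ∀ {b d t} → b + d < m → 0 < d → t < m → ((b + d + t) % m ≡ b) ⇔ (d + t ≡ m)
  [b+d+t]%m≡b⇔d+t≡m {b} {d} {t} b+d<m 0<d t<m = mk⇔ to from
    where
    b<m : b < m
    b<m = ≤-<-trans (m≤m+n b d) b+d<m
    to : (b + d + t) % m ≡ b → d + t ≡ m
    to e with x%m≡b⇒x≡b⊎x≡b+m b<m (+-mono-< b+d<m t<m) e
    ... | inj₁ b+d+t≡b   = contradiction (m+n≡0⇒m≡0 d (+-cancelˡ-≡ b (d + t) 0
                             (trans (sym (+-assoc b d t)) (trans b+d+t≡b (sym (+-identityʳ b)))))) (n>0⇒n≢0 0<d)
    ... | inj₂ b+d+t≡b+m = +-cancelˡ-≡ b (d + t) m (trans (sym (+-assoc b d t)) b+d+t≡b+m)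
    from : d + t ≡ m → (b + d + t) % m ≡ b
    from d+t≡m = begin
      (b + d + t) % m    ≡⟨ cong (_% m) (trans (+-assoc b d t) (cong (b +_) d+t≡m)) ⟩
      (b + m) % m        ≡⟨ [m+n]%n≡m%n b m ⟩
      b % m              ≡⟨ m<n⇒m%n≡m b<m ⟩
      b                  ∎
      where open ≡-Reasoning

  distance⇔rotation : ∀ {a b s} → a < m → b < m → 0 < s → s < m →
    (absDiff a b ≡ s ⊎ absDiff a b ≡ m ∸ s) ⇔ ((a + s) % m ≡ b ⊎ (a + (m ∸ s)) % m ≡ b)
  distance⇔rotation {a} {b} {s} a<m b<m 0<s s<m with a ≤? b
  ... | yes a≤b with m≤n⇒∃[o]m+o≡n a≤b
  ...   | d , refl = begin
    (absDiff a (a + d) ≡ s ⊎ absDiff a (a + d) ≡ m ∸ s)  ≡⟨ cong (λ D → D ≡ s ⊎ D ≡ m ∸ s) (absDiff[m,m+n]≡n a d) ⟩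
    (d ≡ s ⊎ d ≡ m ∸ s)                                  ∼⟨ ≡-sym-⇔ ⊎-⇔ ≡-sym-⇔ ⟩
    (s ≡ d ⊎ m ∸ s ≡ d)                                  ∼⟨ ⇔-sym ([a+t]%m≡a+d⇔t≡d b<m s<m)
                                                            ⊎-⇔ ⇔-sym ([a+t]%m≡a+d⇔t≡d b<m (∸-monoʳ-< 0<s (<⇒≤ s<m))) ⟩
    ((a + s) % m ≡ a + d ⊎ (a + (m ∸ s)) % m ≡ a + d)    ∎
    where open EquationalReasoning
  distance⇔rotation {a} {b} {s} a<m b<m 0<s s<m | no a≰b with m≤n⇒∃[o]m+o≡n (≰⇒≥ a≰b)
  ...   | d , refl = begin
    (absDiff (b + d) b ≡ s ⊎ absDiff (b + d) b ≡ m ∸ s)  ≡⟨ cong (λ D → D ≡ s ⊎ D ≡ m ∸ s) (absDiff[m+n,m]≡n b d) ⟩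
    (d ≡ s ⊎ d ≡ m ∸ s)                                  ↔⟨ ⊎-comm _ _ ⟩
    (d ≡ m ∸ s ⊎ d ≡ s)                                  ∼⟨ ⇔-sym (m+n≡o⇔m≡o∸n (<⇒≤ s<m)) ⊎-⇔ ⇔-sym (m+[o∸n]≡o⇔m≡n (<⇒≤ s<m)) ⟩
    (d + s ≡ m ⊎ d + (m ∸ s) ≡ m)                        ∼⟨ ⇔-sym ([b+d+t]%m≡b⇔d+t≡m a<m 0<d s<m)
                                                            ⊎-⇔ ⇔-sym ([b+d+t]%m≡b⇔d+t≡m a<m 0<d (∸-monoʳ-< 0<s (<⇒≤ s<m))) ⟩
    ((b + d + s) % m ≡ b ⊎ (b + d + (m ∸ s)) % m ≡ b)    ∎
    where
    open EquationalReasoning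
    0<d : 0 < d
    0<d = n≢0⇒n>0 (λ { refl → a≰b (≤-reflexive (+-identityʳ b)) })

rotate : ∀ {m} .{{_ : NonZero m}} → Fin m → ℕ → Fin m
rotate {m} i t = (toℕ i + t) mod m

IsOpenXORMagic : (m : ℕ) (S : List ℕ) {k : ℕ} → (Fin m → Z2^ k) → Set
IsOpenXORMagic m S {k} L = (i : Fin m) → sumV (map L (neighbours m S i)) ≡ zeroV k

module _ {m : ℕ} .{{_ : NonZero m}} where

  ≡rotate⇔ : ∀ {i j : Fin m} {t} → (j ≡ rotate i t) ⇔ ((toℕ i + t) % m ≡ toℕ j)
  ≡rotate⇔ = mk⇔ (λ { refl → sym (toℕ-fromℕ< _) }) (λ e → toℕ-injective (trans (sym e) (sym (toℕ-fromℕ< _))))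

  rotate-injective : ∀ (i : Fin m) {s t} → s < m → t < m → rotate i s ≡ rotate i t → s ≡ t
  rotate-injective i {s} {t} s<m t<m eq
    with x%m≡b⇒x≡b⊎x≡b+m c<m (bound s<m) (Equivalence.to (≡rotate⇔ {i}) refl)
       | x%m≡b⇒x≡b⊎x≡b+m c<m (bound t<m) (Equivalence.to (≡rotate⇔ {i}) eq)
    where
    c<m = toℕ<n (rotate i s)
    bound : ∀ {u} → u < m → toℕ i + u < m + m
    bound u<m = +-mono-< (toℕ<n i) u<m
  ... | inj₁ x | inj₁ y = +-cancelˡ-≡ _ s t (trans x (sym y))
  ... | inj₂ x | inj₂ y = +-cancelˡ-≡ _ s t (trans x (sym y))
  ... | inj₁ x | inj₂ y = contradiction (m+n≡m+o+p⇒p≤n (trans y (cong (_+ m) (sym x)))) (<⇒≱ t<m)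
  ... | inj₂ x | inj₁ y = contradiction (m+n≡m+o+p⇒p≤n (trans x (cong (_+ m) (sym y)))) (<⇒≱ s<m)

  circAdj⇔ : ∀ {S} → All (λ s → 0 < s × s < m) S → (i j : Fin m) →
             CircAdj m S i j ⇔ Any (λ s → j ≡ rotate i s ⊎ j ≡ rotate i (m ∸ s)) S
  circAdj⇔ {S} bounds i j = mk⇔ (λ (_ , dist) → Any-map-All (All.map (Equivalence.to ∘ pointwise) bounds) dist) from
    where
    pointwise : ∀ {s} → 0 < s × s < m →
      (absDiff (toℕ i) (toℕ j) ≡ s ⊎ absDiff (toℕ i) (toℕ j) ≡ m ∸ s) ⇔ (j ≡ rotate i s ⊎ j ≡ rotate i (m ∸ s))
    pointwise (0<s , s<m) =
      ⇔-trans (distance⇔rotation (toℕ<n i) (toℕ<n j) 0<s s<m) (⇔-sym (≡rotate⇔ {i}) ⊎-⇔ ⇔-sym (≡rotate⇔ {i}))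
    from : Any (λ s → j ≡ rotate i s ⊎ j ≡ rotate i (m ∸ s)) S → CircAdj m S i j
    from rot = i≢j , dist
      where
      dist = Any-map-All (All.map (Equivalence.from ∘ pointwise) bounds) rot
      i≢j : i ≢ j
      i≢j refl = All¬⇒¬Any (All.map zero-distance bounds)
                   (subst (λ D → Any (λ s → D ≡ s ⊎ D ≡ m ∸ s) S) (absDiff[n,n]≡0 (toℕ i)) dist)
        where
        zero-distance : ∀ {s} → 0 < s × s < m → ¬ (0 ≡ s ⊎ 0 ≡ m ∸ s)
        zero-distance (0<s , s<m) = [ <⇒≢ 0<s , (λ e → m>n⇒m∸n≢0 s<m (sym e)) ]′

  neighbours↭rotations : ∀ {S T} (i : Fin m) → All (λ s → 0 < s × s < m) S →
    (∀ {j} → Any (λ s → j ≡ rotate i s ⊎ j ≡ rotate i (m ∸ s)) S ⇔ Any (λ t → j ≡ rotate i t) T) →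
    Unique (map (rotate i) T) → neighbours m S i ↭ map (rotate i) T
  neighbours↭rotations {S} {T} i bounds offsets unique =
    ∼bag⇒↭ (unique∧set⇒bag (filter⁺ (circAdj? m S i) (allFin⁺ m)) unique λ {j} → begin
      j ∈ neighbours m S i
        ∼⟨ mk⇔ (proj₂ ∘ ∈-filter⁻ (circAdj? m S i) {xs = allFin m}) (∈-filter⁺ (circAdj? m S i) {xs = allFin m} (∈-allFin j)) ⟩
      CircAdj m S i j
        ∼⟨ circAdj⇔ bounds i j ⟩
      Any (λ s → j ≡ rotate i s ⊎ j ≡ rotate i (m ∸ s)) S
        ∼⟨ offsets ⟩
      Any (λ t → j ≡ rotate i t) T
        ↔⟨ map↔ ⟩
      j ∈ map (rotate i) T ∎)
    where open EquationalReasoning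

-- h = 4 + H encodes h ≥ 4, which keeps the offsets 1 < h − 2 < h < h + 2 < m − 1 apart,
-- and lets h ∸ 2 and m ∸ 1 reduce to terms without ∸.
module C2h (H : ℕ) where
  h m : ℕ
  h = 4 + H
  m = h + h

  S offsets : List ℕ
  S = 1 ∷ h ∸ 2 ∷ h ∷ []
  -- S together with m ∸ S, listing m ∸ h = h only once.
  offsets = 1 ∷ h ∸ 2 ∷ h ∷ h + 2 ∷ m ∸ 1 ∷ []

  h∸2<h : h ∸ 2 < h
  h∸2<h = m<n+m (2 + H) {2} z<s

  h<m : h < m
  h<m = m<m+n h z<s

  S-bounds : All (λ s → 0 < s × s < m) S
  S-bounds = (z<s , s≤s (s≤s z≤n)) ∷ (z<s , <-trans h∸2<h h<m) ∷ (z<s , h<m) ∷ []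

  offsets-increasing : Linked (λ s t → s < t × t < m) offsets
  offsets-increasing = (s≤s (s≤s z≤n) , <-trans h∸2<h h<m)
                     ∷ (h∸2<h , h<m)
                     ∷ (m<m+n h z<s , <-trans h+2<m∸1 (n<1+n _))
                     ∷ (h+2<m∸1 , n<1+n _)
                     ∷ [-]
    where
    h+2<m∸1 : h + 2 < m ∸ 1
    h+2<m∸1 = subst (h + 2 <_) (h+[h∸1]≡m∸1 H) (+-monoʳ-< h (s≤s (s≤s (s≤s z≤n))))
      where
      h+[h∸1]≡m∸1 : ∀ H → (4 + H) + (3 + H) ≡ 3 + (H + (4 + H))
      h+[h∸1]≡m∸1 = solve-∀

  m∸[h∸2]≡h+2 : m ∸ (h ∸ 2) ≡ h + 2
  m∸[h∸2]≡h+2 = trans (cong (_∸ (2 + H)) (sym (split H))) (m+n∸m≡n (2 + H) (h + 2))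
    where
    split : ∀ H → (2 + H) + ((4 + H) + 2) ≡ (4 + H) + (4 + H)
    split = solve-∀

  Any-offsets⇔ : {P : ℕ → Set} → Any (λ s → P s ⊎ P (m ∸ s)) S ⇔ Any P offsets
  Any-offsets⇔ {P} = mk⇔ to from
    where
    to : Any (λ s → P s ⊎ P (m ∸ s)) S → Any P offsets
    to (here (inj₁ p))                 = here p
    to (here (inj₂ p))                 = there (there (there (there (here p))))
    to (there (here (inj₁ p)))         = there (here p)
    to (there (here (inj₂ p)))         = there (there (there (here (subst P m∸[h∸2]≡h+2 p))))
    to (there (there (here (inj₁ p)))) = there (there (here p))
    to (there (there (here (inj₂ p)))) = there (there (here (subst P (m+n∸m≡n h h) p)))
    from : Any P offsets → Any (λ s → P s ⊎ P (m ∸ s)) S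
    from (here p)                                 = here (inj₁ p)
    from (there (here p))                         = there (here (inj₁ p))
    from (there (there (here p)))                 = there (there (here (inj₁ p)))
    from (there (there (there (here p))))         = there (here (inj₂ (subst P (sym m∸[h∸2]≡h+2) p)))
    from (there (there (there (there (here p))))) = here (inj₂ p)

  neighbours↭offsets : (i : Fin m) → neighbours m S i ↭ map (rotate i) offsets
  neighbours↭offsets i = neighbours↭rotations i S-bounds Any-offsets⇔
    (AllPairs-map⁺ (AllPairs.map rotations-distinct (Linked⇒AllPairs <<-trans offsets-increasing)))
    where
    <<-trans : ∀ {s t u} → s < t × t < m → t < u × u < m → s < u × u < m
    <<-trans (s<t , _) (t<u , u<m) = <-trans s<t t<u , u<m
    rotations-distinct : ∀ {s t} → s < t × t < m → rotate i s ≢ rotate i t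
    rotations-distinct (s<t , t<m) = <⇒≢ s<t ∘ rotate-injective i (<-trans s<t t<m) t<m

  module _ {k : ℕ} (L : Fin m → Z2^ k) (magic : IsOpenXORMagic m S L) where
    open CommutativeMonoid (⊕-commutativeMonoid k) using (identityˡ; comm)

    G : ℕ → Z2^ k
    G y = L (y mod m)

    G-periodic : Periodic G m
    G-periodic y = cong L (fromℕ<-cong ((y + m) % m) (y % m) ([m+n]%n≡m%n y m) _ _)

    rotations-sum : ∀ x → sumV (map (λ t → G (x + t)) offsets) ≡ zeroV k
    rotations-sum x = begin
      sumV (map (λ t → G (x + t)) offsets)        ≡⟨ cong sumV (map-cong G≗L∘rotate offsets) ⟩
      sumV (map (L ∘ rotate i) offsets)           ≡⟨ cong sumV (map-∘ {g = L} {f = rotate i} offsets) ⟩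
      sumV (map L (map (rotate i) offsets))       ≡⟨ sumV-↭ (↭-map⁺ L (↭-sym (neighbours↭offsets i))) ⟩
      sumV (map L (neighbours m S i))             ≡⟨ magic i ⟩
      zeroV k                                     ∎
      where
      open ≡-Reasoning
      i = x mod m
      G≗L∘rotate : ∀ t → G (x + t) ≡ L (rotate i t)
      G≗L∘rotate t = cong L (fromℕ<-cong ((x + t) % m) ((toℕ i + t) % m) (sym same-residue) _ _)
        where
        same-residue : (toℕ i + t) % m ≡ (x + t) % m
        same-residue = trans (cong (λ a → (a + t) % m) (toℕ-fromℕ< (m%n<n x m))) ([m%d+n]%d≡[m+n]%d x t m)

    F : ℕ → Z2^ k
    F y = G y ⊕ G (y + h)

    F-periodic : Periodic F h
    F-periodic y = begin
      G (y + h) ⊕ G (y + h + h)  ≡⟨ cong (G (y + h) ⊕_) (trans (cong G (+-assoc y h h)) (G-periodic y)) ⟩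
      G (y + h) ⊕ G y            ≡⟨ comm (G (y + h)) (G y) ⟩
      G y ⊕ G (y + h)            ∎
      where open ≡-Reasoning

    F-mod-h : ∀ {a} b q → a ≡ b + q * h → F a ≡ F b
    F-mod-h b q a≡b+qh = trans (cong F a≡b+qh) (periodic-* F-periodic q b)

    F-rotations-sum : ∀ x → sumV (map (λ t → F (x + t)) offsets) ≡ zeroV k
    F-rotations-sum x = begin
      sumV (map (λ t → F (x + t)) offsets)
        ≡⟨ sumV-map-⊕ (λ t → G (x + t)) (λ t → G (x + t + h)) offsets ⟩
      sumV (map (λ t → G (x + t)) offsets) ⊕ sumV (map (λ t → G (x + t + h)) offsets)
        ≡⟨ cong (sumV (map (λ t → G (x + t)) offsets) ⊕_) (cong sumV (map-cong (λ t → cong G (xy∙z≈xz∙y x t h)) offsets)) ⟩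
      sumV (map (λ t → G (x + t)) offsets) ⊕ sumV (map (λ t → G (x + h + t)) offsets)
        ≡⟨ cong₂ _⊕_ (rotations-sum x) (rotations-sum (x + h)) ⟩
      zeroV k ⊕ zeroV k
        ≡⟨ identityˡ (zeroV k) ⟩
      zeroV k ∎
      where
      open ≡-Reasoning
      open import Algebra.Properties.CommutativeSemigroup +-commutativeSemigroup using (xy∙z≈xz∙y)

    F-window : ∀ y → F y ⊕ (F (1 + y) ⊕ (F (2 + y) ⊕ (F (3 + y) ⊕ F (4 + y)))) ≡ zeroV k
    F-window y = begin
      F y ⊕ (F (1 + y) ⊕ (F (2 + y) ⊕ (F (3 + y) ⊕ F (4 + y))))
        ≡⟨ solve 5 (λ a b c d e → a ∙ (b ∙ (c ∙ (d ∙ e))) ⊜ d ∙ (a ∙ (c ∙ (e ∙ (b ∙ ε))))) refl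
                 (F y) (F (1 + y)) (F (2 + y)) (F (3 + y)) (F (4 + y)) ⟩
      F (3 + y) ⊕ (F y ⊕ (F (2 + y) ⊕ (F (4 + y) ⊕ (F (1 + y) ⊕ zeroV k))))
        ≡⟨ cong₂ _⊕_ (F-mod-h (3 + y) 0 (shift-1 y H))
             (cong₂ _⊕_ (F-mod-h y 1 (shift-h∸2 y H))
             (cong₂ _⊕_ (F-mod-h (2 + y) 1 (shift-h y H))
             (cong₂ _⊕_ (F-mod-h (4 + y) 1 (shift-h+2 y H))
             (cong₂ _⊕_ (F-mod-h (1 + y) 2 (shift-m∸1 y H)) refl)))) ⟨
      sumV (map (λ t → F (2 + y + t)) offsets)
        ≡⟨ F-rotations-sum (2 + y) ⟩
      zeroV k ∎
      where
      open ≡-Reasoning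
      open import Algebra.Solver.CommutativeMonoid (⊕-commutativeMonoid k) using (solve; _⊜_) renaming (_⊕_ to _∙_; id to ε)
      shift-1 : ∀ y H → 2 + y + 1 ≡ 3 + y + 0 * (4 + H)
      shift-1 = solve-∀
      shift-h∸2 : ∀ y H → 2 + y + (2 + H) ≡ y + 1 * (4 + H)
      shift-h∸2 = solve-∀
      shift-h : ∀ y H → 2 + y + (4 + H) ≡ 2 + y + 1 * (4 + H)
      shift-h = solve-∀
      shift-h+2 : ∀ y H → 2 + y + ((4 + H) + 2) ≡ 4 + y + 1 * (4 + H)
      shift-h+2 = solve-∀
      shift-m∸1 : ∀ y H → 2 + y + (3 + (H + (4 + H))) ≡ 1 + y + 2 * (4 + H)
      shift-m∸1 = solve-∀

    F-periodic-5 : Periodic F 5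
    F-periodic-5 y = begin
      F (y + 5)                                         ≡⟨ cong F (+-comm y 5) ⟩
      F (5 + y)                                         ≡⟨ ⊕≡zero⇒≡ (trans shift-window (F-window (1 + y))) ⟩
      F (1 + y) ⊕ (F (2 + y) ⊕ (F (3 + y) ⊕ F (4 + y))) ≡⟨ ⊕≡zero⇒≡ (F-window y) ⟨
      F y                                               ∎
      where
      open ≡-Reasoning
      open import Algebra.Solver.CommutativeMonoid (⊕-commutativeMonoid k) using (solve; _⊜_) renaming (_⊕_ to _∙_)
      shift-window : F (5 + y) ⊕ (F (1 + y) ⊕ (F (2 + y) ⊕ (F (3 + y) ⊕ F (4 + y))))
                   ≡ F (1 + y) ⊕ (F (2 + y) ⊕ (F (3 + y) ⊕ (F (4 + y) ⊕ F (5 + y))))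
      shift-window = solve 5 (λ a b c d e → e ∙ (a ∙ (b ∙ (c ∙ d))) ⊜ a ∙ (b ∙ (c ∙ (d ∙ e)))) refl
                       (F (1 + y)) (F (2 + y)) (F (3 + y)) (F (4 + y)) (F (5 + y))

    F0≡0 : Coprime 5 h → F 0 ≡ zeroV k
    F0≡0 coprime = begin
      F 0                                  ≡⟨ x⊕x⊕x⊕x⊕x≡x (F 0) ⟨
      F 0 ⊕ (F 0 ⊕ (F 0 ⊕ (F 0 ⊕ F 0)))    ≡⟨ cong (F 0 ⊕_) (cong₂ _⊕_ (F-constant 1)
                                               (cong₂ _⊕_ (F-constant 2) (cong₂ _⊕_ (F-constant 3) (F-constant 4)))) ⟨
      F 0 ⊕ (F 1 ⊕ (F 2 ⊕ (F 3 ⊕ F 4)))    ≡⟨ F-window 0 ⟩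
      zeroV k                              ∎
      where
      open ≡-Reasoning
      F-constant : ∀ y → F y ≡ F 0
      F-constant = periodic-1⇒constant (subst (Periodic F) (coprime⇒gcd≡1 coprime) (periodic-gcd F-periodic-5 F-periodic))

  no-injective-open-XOR-magic : ∀ {k} → Coprime 5 h → (L : Fin m → Z2^ k) → Injective _≡_ _≡_ L → ¬ IsOpenXORMagic m S L
  no-injective-open-XOR-magic coprime L L-injective magic = h≢0 (begin
    h                ≡⟨ m<n⇒m%n≡m h<m ⟨
    h % m            ≡⟨ toℕ-fromℕ< (m%n<n h m) ⟨
    toℕ (h mod m)    ≡⟨ cong toℕ (L-injective (⊕≡zero⇒≡ (F0≡0 L magic coprime))) ⟨
    toℕ (0 mod m)    ≡⟨ toℕ-fromℕ< (m%n<n 0 m) ⟩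
    0                ∎)
    where
    open ≡-Reasoning
    h≢0 : h ≢ 0
    h≢0 ()

no-injective-open-XOR-magic : ∀ {h k} → 4 ≤ h → Coprime 5 h → (L : Fin (h + h) → Z2^ k) → Injective _≡_ _≡_ L →
                              ¬ IsOpenXORMagic (h + h) (1 ∷ h ∸ 2 ∷ h ∷ []) L
no-injective-open-XOR-magic (s≤s (s≤s (s≤s (s≤s (z≤n {H}))))) = C2h.no-injective-open-XOR-magic H

no-open-XOR-magic-labeling : ∀ {h k} → 4 ≤ h → Coprime 5 h → ¬ OpenXORMagicLabeling (h + h) k (1 ∷ h ∸ 2 ∷ h ∷ [])
no-open-XOR-magic-labeling 4≤h coprime (ℓ , magic) =
  no-injective-open-XOR-magic 4≤h coprime (Bijection.to ℓ) (Bijection.injective ℓ) magic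

prime∤⇒coprime : ∀ {p n} → Prime p → p ∤ n → Coprime p n
prime∤⇒coprime pp p∤n (d∣p , d∣n) with prime⇒irreducible pp d∣p
... | inj₁ d≡1 = d≡1
... | inj₂ refl = contradiction d∣n p∤n

prime∤⇒∤^ : ∀ {p a} → Prime p → p ∤ a → ∀ n → p ∤ a ^ n
prime∤⇒∤^ pp p∤a zero    p∣1     = nonTrivial⇒≢1 {{prime⇒nonTrivial pp}} (∣1⇒≡1 p∣1)
prime∤⇒∤^ pp p∤a (suc n) p∣a*a^n = [ p∤a , prime∤⇒∤^ pp p∤a n ]′ (euclidsLemma _ _ pp p∣a*a^n)

coprime[5,2^n] : ∀ n → Coprime 5 (2 ^ n)
coprime[5,2^n] n = prime∤⇒coprime prime[5] (prime∤⇒∤^ prime[5] (>⇒∤ (s≤s (s≤s (s≤s z≤n)))) n)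
  where
  prime[5] : Prime 5
  prime[5] = from-yes (prime? 5)

theorem4 : (n : ℕ) → n > 2 →
    ¬ OpenXORMagicLabeling (2 ^ n) n (1 ∷ (2 ^ (n ∸ 1) ∸ 2) ∷ 2 ^ (n ∸ 1) ∷ [])
theorem4 (suc n) (s≤s 2≤n) =
  subst (λ m → ¬ OpenXORMagicLabeling m (suc n) (1 ∷ 2 ^ n ∸ 2 ∷ 2 ^ n ∷ [])) 2^n+2^n≡2^[1+n]
        (no-open-XOR-magic-labeling (^-monoʳ-≤ 2 2≤n) (coprime[5,2^n] n))
  where
  2^n+2^n≡2^[1+n] : 2 ^ n + 2 ^ n ≡ 2 ^ suc n
  2^n+2^n≡2^[1+n] = cong (2 ^ n +_) (sym (+-identityʳ (2 ^ n)))
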